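{- Let $r,s$ be positive integers and let $(P,Q)$ with the associated template be one of Cases (1)–(4) below. Let $p$ be a prime with $p\equiv1\pmod s$, $n=p^2$, and let $t:\{0,1\}^n\to\{0,1\}$ be a doubly cyclic polymorphism of the template. Let $k^i_j$ ($i\in[p]$, $j\in[s]$) be integers with $0\le k^i_j\le p$ such that $\sum_{j=1}^s k^i_j=rp$ for every $i\in[p]$, and put $\mathbf k_j=\langle k^1_j,\dots,k^p_j\rangle$. Then $(t(\mathbf k_1),\dots,t(\mathbf k_s))\in Q$.
   Context: Relations: $r\text{ -in- }s=\{x\in\{0,1\}^s:\sum x_i=r\}$, $\leq\! r\text{ -in- }s=\{x:\sum x_i\le r\}$, $\text{not-all-equal- }s=\{x\in\{0,1\}^s:\sum x_i\notin\{0,s\}\}$. Cases: (1) $P=r\text{ -in- }s$, $Q=\leq\!(2r-1)\text{ -in- }s$, $1<r<s/2$, together with the disequality pair $(\neq,\neq)$; (2) $P=\leq\! r\text{ -in- }s$, $Q=\leq\!(2r-1)\text{ -in- }s$, $s$ even, $1<r=s/2$, with disequality pair; (3) $P=r\text{ -in- }s$, $Q=\leq\!(2r-1)\text{ -in- }s$, $s$ even, $1<r=s/2$, $r$ even, with disequality pair; (4) $P=r\text{ -in- }s$, $Q=\text{not-all-equal- }s$, $s>r$, $s>2$, $r\le s/2$, $r$ even or $s$ odd, no disequality pair. A function $f:\{0,1\}^N\to\{0,1\}$ is a polymorphism of the template if whenever $u_1,\dots,u_N\in P$ the tuple $(f(u_1(j),\dots,u_N(j)))_{j=1}^s$ lies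 in $Q$, and, in Cases (1)–(3), additionally $f(1-x_1,\dots,1-x_N)=1-f(x_1,\dots,x_N)$. Doubly cyclic: writing the $p^2$ arguments as $p$ consecutive blocks $\mathbf x_1,\dots,\mathbf x_p$ of length $p$, $t(\mathbf x_1,\dots,\mathbf x_p)=t(\mathbf y_1,\dots,\mathbf y_p)$ whenever each $\mathbf y_i$ is a cyclic shift of $\mathbf x_i$, and $t(\mathbf x_1,\dots,\mathbf x_p)=t(\mathbf x_2,\dots,\mathbf x_p,\mathbf x_1)$. For $0\le k\le p$, $\langle k\rangle_p$ is the $p$-tuple of $k$ ones followed by $p-k$ zeros, and $\langle k^1,\dots,k^p\rangle$ is the $n$-tuple obtained by concatenating $\langle k^1\rangle_p,\dots,\langle k^p\rangle_p$ in this order. -}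

module Defs where

open import Data.Nat using (ℕ; zero; suc; _+_; _*_; _∸_; _≤_; _<_; _<ᵇ_; _%_)
open import Data.Nat.DivMod using (m%n<n)
open import Data.Empty using (⊥)
open import Data.Unit using (⊤)
open import Data.Nat.Divisibility using (_∣_)
open import Data.Bool using (Bool; true; false; not; if_then_else_)
open import Data.Fin using (Fin; toℕ; fromℕ<; remQuot)
open import Data.Vec using (tabulate; sum)
open import Data.Product using (_×_; _,_; proj₁; proj₂)
open import Data.Sum using (_⊎_)
open import Relation.Nullary using (¬_)
open import Relation.Binary.PropositionalEquality using (_≡_; _≢_)

Tuple : ℕ → Set
Tuple s = Fin s → Bool

sumFin : ∀ {s} → (Fin s → ℕ) → ℕ
sumFin f = sum (tabulate f)

weight : ∀ {s} → Tuple s → ℕ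
weight x = sumFin (λ j → if x j then 1 else 0)

r-in-s : (r s : ℕ) → Tuple s → Set
r-in-s r s x = weight x ≡ r

≤r-in-s : (r s : ℕ) → Tuple s → Set
≤r-in-s r s x = weight x ≤ r

not-all-equal : (s : ℕ) → Tuple s → Set
not-all-equal s x = (weight x ≢ 0) × (weight x ≢ s)

data Case (r s : ℕ) : Set where
  case1 : 1 < r → 2 * r < s → Case r s
  case2 : 2 ∣ s → 1 < r → 2 * r ≡ s → Case r s
  case3 : 2 ∣ s → 1 < r → 2 * r ≡ s → 2 ∣ r → Case r s
  case4 : r < s → 2 < s → 2 * r ≤ s → (2 ∣ r ⊎ ¬ (2 ∣ s)) → Case r s

P : ∀ {r s} → Case r s → Tuple s → Set
P {r} {s} (case1 _ _)       = r-in-s r s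
P {r} {s} (case2 _ _ _)     = ≤r-in-s r s
P {r} {s} (case3 _ _ _ _)   = r-in-s r s
P {r} {s} (case4 _ _ _ _)   = r-in-s r s

Q : ∀ {r s} → Case r s → Tuple s → Set
Q {r} {s} (case1 _ _)       = ≤r-in-s (2 * r ∸ 1) s
Q {r} {s} (case2 _ _ _)     = ≤r-in-s (2 * r ∸ 1) s
Q {r} {s} (case3 _ _ _ _)   = ≤r-in-s (2 * r ∸ 1) s
Q {r} {s} (case4 _ _ _ _)   = not-all-equal s

-- Whether the template includes the disequality pair (≠,≠)
HasDiseq : ∀ {r s} → Case r s → Set
HasDiseq (case4 _ _ _ _) = ⊥
HasDiseq _               = ⊤

IsPolymorphism : ∀ {r s} → Case r s → (N : ℕ) → (Tuple N → Bool) → Set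
IsPolymorphism {r} {s} c N f =
  ((u : Fin N → Tuple s) → (∀ i → P c (u i)) → Q c (λ j → f (λ i → u i j)))
  × (HasDiseq c → ∀ (x : Tuple N) → f (λ i → not (x i)) ≡ not (f x))

shiftIdx : ∀ {p} → ℕ → Fin p → Fin p
shiftIdx {suc m} c j = fromℕ< (m%n<n (toℕ j + c) (suc m))

-- Arguments of a p²-ary function given as p blocks of length p:
-- argument index combine i j (= i*p + j) is the j-th entry of block i.
fromBlocks : ∀ {p} → (Fin p → Fin p → Bool) → Tuple (p * p)
fromBlocks {p} B k = B (proj₁ (remQuot {p} p k)) (proj₂ (remQuot {p} p k))

DoublyCyclic : (p : ℕ) → (Tuple (p * p) → Bool) → Set
DoublyCyclic p t =
  ((B : Fin p → Fin p → Bool) (c : Fin p → ℕ) →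
     t (fromBlocks B) ≡ t (fromBlocks (λ i j → B i (shiftIdx (c i) j))))
  × ((B : Fin p → Fin p → Bool) →
     t (fromBlocks B) ≡ t (fromBlocks (λ i → B (shiftIdx 1 i))))

⟨_⟩[_] : ℕ → (p : ℕ) → Fin p → Bool
⟨ k ⟩[ p ] j = toℕ j <ᵇ k

⟪_⟫ : ∀ {p} → (Fin p → ℕ) → Tuple (p * p)
⟪_⟫ {p} ks = fromBlocks (λ i → ⟨ ks i ⟩[ p ])

-- In each block i, place the arcs of lengths k^i_1, …, k^i_s end to end around the
-- cycle ℤ/p, rotating ⟨k^i_j⟩ to start where the previous arc ended.  Their lengths
-- total rp, so they wind around the cycle exactly r times and every position lies in
-- exactly r of them: each column of the rotated arguments has weight r, hence lies in
-- P, and the polymorphism t maps the columns into Q.  Since t is invariant under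
-- rotating blocks independently, it takes the same values on the unrotated ⟨k^i_j⟩.
module Submission where

open import Defs
open import Data.Nat using (ℕ; zero; suc; _+_; _*_; _∸_; _≤_; _<_; _%_; NonZero)
open import Data.Nat.Properties
open import Data.Nat.DivMod using (%-distribˡ-+; m%n%n≡m%n; m%n≤n; m%n<n; n%n≡0; m*n%n≡0; m<n⇒m%n≡m)
open import Data.Nat.Divisibility using (_∣_)
open import Data.Nat.Primality using (Prime; ¬prime[0])
open import Data.Bool using (Bool; if_then_else_)
open import Data.Empty using (⊥-elim)
open import Data.Fin using (Fin; zero; suc; toℕ; remQuot)
open import Data.Fin.Properties using (toℕ<n; toℕ-fromℕ<)
open import Data.Vec using (sum)
open import Data.Vec.Properties using (tabulate-cong)
open import Data.Product using (_,_; proj₁; proj₂)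
open import Function using (_∘_; mk⇔)
open import Relation.Nullary using (does)
open import Relation.Nullary.Decidable using (does-⇔; dec-true; dec-false)
open import Relation.Binary using (tri<; tri≈; tri>)
open import Relation.Binary.PropositionalEquality

𝟙 : Bool → ℕ
𝟙 b = if b then 1 else 0

sumFin-cong : ∀ {s} {f g : Fin s → ℕ} → (∀ j → f j ≡ g j) → sumFin f ≡ sumFin g
sumFin-cong f≗g = cong sum (tabulate-cong f≗g)

weight-cong : ∀ {s} {x y : Tuple s} → (∀ j → x j ≡ y j) → weight x ≡ weight y
weight-cong x≗y = sumFin-cong (cong 𝟙 ∘ x≗y)

prefixSum : ∀ {s} → (Fin s → ℕ) → Fin s → ℕ
prefixSum k zero    = 0
prefixSum k (suc j) = k zero + prefixSum (k ∘ suc) j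

𝟙[<]+𝟙[≡]≡𝟙[<suc] : ∀ m L → 𝟙 (does (m <? L)) + 𝟙 (does (L ≟ m)) ≡ 𝟙 (does (m <? suc L))
𝟙[<]+𝟙[≡]≡𝟙[<suc] m L with <-cmp m L
... | tri< m<L _ _
  rewrite dec-true (m <? L) m<L | dec-false (L ≟ m) (>⇒≢ m<L)
        | dec-true (m <? suc L) (m<n⇒m<1+n m<L) = refl
... | tri≈ _ refl _
  rewrite dec-false (m <? m) (n≮n m) | dec-true (m ≟ m) refl
        | dec-true (m <? suc m) (n<1+n m) = refl
... | tri> _ _ L<m
  rewrite dec-false (m <? L) (<⇒≯ L<m) | dec-false (L ≟ m) (<⇒≢ L<m)
        | dec-false (m <? suc L) (≤⇒≯ L<m) = refl

module Residues (p : ℕ) .{{_ : NonZero p}} where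

  infix 4 _≈_
  _≈_ : ℕ → ℕ → Set
  a ≈ b = a % p ≡ b % p

  %-≈ : ∀ a → a % p ≈ a
  %-≈ a = m%n%n≡m%n a p

  +-congʳ-≈ : ∀ {a b} c → a ≈ b → a + c ≈ b + c
  +-congʳ-≈ {a} {b} c a≈b = begin
    (a + c) % p           ≡⟨ %-distribˡ-+ a c p ⟩
    (a % p + c % p) % p   ≡⟨ cong (λ z → (z + c % p) % p) a≈b ⟩
    (b % p + c % p) % p   ≡⟨ %-distribˡ-+ b c p ⟨
    (b + c) % p           ∎
    where open ≡-Reasoning

  +-congˡ-≈ : ∀ {a b} c → a ≈ b → c + a ≈ c + b
  +-congˡ-≈ {a} {b} c a≈b =
    subst₂ _≈_ (+-comm a c) (+-comm b c) (+-congʳ-≈ c a≈b)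

  +-complement-≈ : ∀ a → a + (p ∸ a % p) ≈ 0
  +-complement-≈ a = begin
    (a + (p ∸ a % p)) % p       ≡⟨ +-congʳ-≈ (p ∸ a % p) (%-≈ a) ⟨
    (a % p + (p ∸ a % p)) % p   ≡⟨ cong (_% p) (m+[n∸m]≡n (m%n≤n a p)) ⟩
    p % p                       ≡⟨ n%n≡0 p ⟩
    0                           ≡⟨ m*n%n≡0 0 p ⟨
    0 % p                       ∎
    where open ≡-Reasoning

  +-cancelʳ-≈ : ∀ {a b} c → a + c ≈ b + c → a ≈ b
  +-cancelʳ-≈ {a} {b} c a+c≈b+c = begin
    a % p               ≡⟨ cong (_% p) (+-identityʳ a) ⟨
    (a + 0) % p         ≡⟨ +-congˡ-≈ a (+-complement-≈ c) ⟨
    (a + (c + d)) % p   ≡⟨ cong (_% p) (+-assoc a c d) ⟨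
    (a + c + d) % p     ≡⟨ +-congʳ-≈ d a+c≈b+c ⟩
    (b + c + d) % p     ≡⟨ cong (_% p) (+-assoc b c d) ⟩
    (b + (c + d)) % p   ≡⟨ +-congˡ-≈ b (+-complement-≈ c) ⟩
    (b + 0) % p         ≡⟨ cong (_% p) (+-identityʳ b) ⟩
    b % p               ∎
    where
    open ≡-Reasoning
    d : ℕ
    d = p ∸ c % p

  count : ℕ → ℕ → ℕ → ℕ
  count m a zero    = 0
  count m a (suc L) = 𝟙 (does (a % p ≟ m % p)) + count m (suc a) L

  count-+ : ∀ m a L₁ L₂ → count m a (L₁ + L₂) ≡ count m a L₁ + count m (a + L₁) L₂
  count-+ m a zero     L₂ = cong (λ b → count m b L₂) (sym (+-identityʳ a))
  count-+ m a (suc L₁) L₂ = begin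
    here + count m (suc a) (L₁ + L₂)                        ≡⟨ cong (here +_) (count-+ m (suc a) L₁ L₂) ⟩
    here + (count m (suc a) L₁ + count m (suc a + L₁) L₂)   ≡⟨ +-assoc here _ _ ⟨
    count m a (suc L₁) + count m (suc a + L₁) L₂            ≡⟨ cong (λ b → count m a (suc L₁) + count m b L₂) (+-suc a L₁) ⟨
    count m a (suc L₁) + count m (a + suc L₁) L₂            ∎
    where
    open ≡-Reasoning
    here : ℕ
    here = 𝟙 (does (a % p ≟ m % p))

  count-cong : ∀ {m m′ a a′} L → m ≈ m′ → a ≈ a′ → count m a L ≡ count m′ a′ L
  count-cong zero    m≈m′ a≈a′ = refl
  count-cong (suc L) m≈m′ a≈a′ =
    cong₂ _+_ (cong₂ (λ u v → 𝟙 (does (u ≟ v))) a≈a′ m≈m′)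
              (count-cong L m≈m′ (+-congˡ-≈ 1 a≈a′))

  count-translate : ∀ m a c L → count m a L ≡ count (m + c) (a + c) L
  count-translate m a c zero    = refl
  count-translate m a c (suc L) =
    cong₂ _+_ (cong 𝟙 (does-⇔ (mk⇔ (+-congʳ-≈ c) (+-cancelʳ-≈ c)) (a % p ≟ m % p) ((a + c) % p ≟ (m + c) % p)))
              (count-translate m (suc a) c L)

  count-initial : ∀ {m} L → m < p → L ≤ p → count m 0 L ≡ 𝟙 (does (m <? L))
  count-initial zero    m<p L≤p = refl
  count-initial {m} (suc L) m<p L<p = begin
    count m 0 (suc L)                                 ≡⟨ cong (count m 0) (+-comm 1 L) ⟩
    count m 0 (L + 1)                                 ≡⟨ count-+ m 0 L 1 ⟩
    count m 0 L + (𝟙 (does (L % p ≟ m % p)) + 0)      ≡⟨ cong₂ _+_ (count-initial L m<p (<⇒≤ L<p)) (+-identityʳ _) ⟩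
    𝟙 (does (m <? L)) + 𝟙 (does (L % p ≟ m % p))      ≡⟨ cong₂ (λ u v → _ + 𝟙 (does (u ≟ v))) (m<n⇒m%n≡m L<p) (m<n⇒m%n≡m m<p) ⟩
    𝟙 (does (m <? L)) + 𝟙 (does (L ≟ m))              ≡⟨ 𝟙[<]+𝟙[≡]≡𝟙[<suc] m L ⟩
    𝟙 (does (m <? suc L))                             ∎
    where open ≡-Reasoning

  count-periods : ∀ {m} r → m < p → count m 0 (r * p) ≡ r
  count-periods zero        m<p = refl
  count-periods {m} (suc r) m<p = begin
    count m 0 (p + r * p)             ≡⟨ count-+ m 0 p (r * p) ⟩
    count m 0 p + count m p (r * p)   ≡⟨ cong₂ _+_ (count-initial p m<p ≤-refl) (count-cong (r * p) refl p≈0) ⟩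
    𝟙 (does (m <? p)) + count m 0 (r * p) ≡⟨ cong₂ _+_ (cong 𝟙 (dec-true (m <? p) m<p)) (count-periods r m<p) ⟩
    suc r                             ∎
    where
    open ≡-Reasoning
    p≈0 : p ≈ 0
    p≈0 = trans (n%n≡0 p) (sym (m*n%n≡0 0 p))

  count-consecutive : ∀ {s} m a (k : Fin s → ℕ) →
    sumFin (λ j → count m (a + prefixSum k j) (k j)) ≡ count m a (sumFin k)
  count-consecutive {zero}  m a k = refl
  count-consecutive {suc s} m a k = begin
    count m (a + 0) (k zero) + sumFin (λ j → count m (a + (k zero + prefixSum (k ∘ suc) j)) (k (suc j)))
      ≡⟨ cong₂ _+_ (cong (λ b → count m b (k zero)) (+-identityʳ a))
                   (sumFin-cong (λ j → cong (λ b → count m b (k (suc j))) (sym (+-assoc a (k zero) _)))) ⟩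
    count m a (k zero) + sumFin (λ j → count m (a + k zero + prefixSum (k ∘ suc) j) (k (suc j)))
      ≡⟨ cong (count m a (k zero) +_) (count-consecutive m (a + k zero) (k ∘ suc)) ⟩
    count m a (k zero) + count m (a + k zero) (sumFin (k ∘ suc))
      ≡⟨ count-+ m a (k zero) _ ⟨
    count m a (sumFin k) ∎
    where open ≡-Reasoning

  -- Rotating by p ∸ a % p moves the start a of the arc to position 0.
  count-arc : ∀ {m} a k → m < p → k ≤ p →
    count m a k ≡ 𝟙 (does ((m + (p ∸ a % p)) % p <? k))
  count-arc {m} a k m<p k≤p = begin
    count m a k                   ≡⟨ count-translate m a c k ⟩
    count (m + c) (a + c) k       ≡⟨ count-cong k (sym (%-≈ (m + c))) (+-complement-≈ a) ⟩
    count ((m + c) % p) 0 k       ≡⟨ count-initial k (m%n<n (m + c) p) k≤p ⟩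
    𝟙 (does ((m + c) % p <? k))   ∎
    where
    open ≡-Reasoning
    c : ℕ
    c = p ∸ a % p

module Arcs (n : ℕ) where

  open Residues (suc n)

  -- The indicator of the cyclic interval {a, …, a + k − 1} mod p, as the block rotation
  -- of ⟨k⟩ that DoublyCyclic is invariant under.
  arc : ℕ → ℕ → Fin (suc n) → Bool
  arc a k m = ⟨ k ⟩[ suc n ] (shiftIdx (suc n ∸ a % suc n) m)

  𝟙-arc : ∀ a {k} (m : Fin (suc n)) → k ≤ suc n → 𝟙 (arc a k m) ≡ count (toℕ m) a k
  𝟙-arc a {k} m k≤p = begin
    𝟙 (arc a k m)                                           ≡⟨ cong (λ i → 𝟙 (does (i <? k))) (toℕ-fromℕ< _) ⟩
    𝟙 (does ((toℕ m + (suc n ∸ a % suc n)) % suc n <? k))   ≡⟨ count-arc a k (toℕ<n m) k≤p ⟨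
    count (toℕ m) a k                                       ∎
    where open ≡-Reasoning

  arcs-cover : ∀ {s} r (k : Fin s → ℕ) → (∀ j → k j ≤ suc n) → sumFin k ≡ r * suc n →
    ∀ m → weight (λ j → arc (prefixSum k j) (k j) m) ≡ r
  arcs-cover r k k≤p Σk≡rp m = begin
    weight (λ j → arc (prefixSum k j) (k j) m)            ≡⟨ sumFin-cong (λ j → 𝟙-arc (prefixSum k j) m (k≤p j)) ⟩
    sumFin (λ j → count (toℕ m) (prefixSum k j) (k j))   ≡⟨ count-consecutive (toℕ m) 0 k ⟩
    count (toℕ m) 0 (sumFin k)                           ≡⟨ cong (count (toℕ m) 0) Σk≡rp ⟩
    count (toℕ m) 0 (r * suc n)                          ≡⟨ count-periods r (toℕ<n m) ⟩
    r                                                    ∎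
    where open ≡-Reasoning

weight≡r⇒P : ∀ {r s} (c : Case r s) {x : Tuple s} → weight x ≡ r → P c x
weight≡r⇒P (case1 _ _)       w≡r = w≡r
weight≡r⇒P (case2 _ _ _)     w≡r = ≤-reflexive w≡r
weight≡r⇒P (case3 _ _ _ _)   w≡r = w≡r
weight≡r⇒P (case4 _ _ _ _)   w≡r = w≡r

Q-respects-weight : ∀ {r s} (c : Case r s) {x y : Tuple s} → weight x ≡ weight y → Q c x → Q c y
Q-respects-weight (case1 _ _)       wx≡wy = subst (_≤ _) wx≡wy
Q-respects-weight (case2 _ _ _)     wx≡wy = subst (_≤ _) wx≡wy
Q-respects-weight (case3 _ _ _ _)   wx≡wy = subst (_≤ _) wx≡wy
Q-respects-weight (case4 _ _ _ _)   wx≡wy (w≢0 , w≢s) =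
  (λ wy≡0 → w≢0 (trans wx≡wy wy≡0)) , (λ wy≡s → w≢s (trans wx≡wy wy≡s))

lemma27 : (r s : ℕ) → 1 ≤ r → 1 ≤ s → (c : Case r s) →
          (p : ℕ) → Prime p → s ∣ p ∸ 1 →
          (t : Tuple (p * p) → Bool) → IsPolymorphism c (p * p) t → DoublyCyclic p t →
          (k : Fin p → Fin s → ℕ) → (∀ i j → k i j ≤ p) →
          (∀ i → sumFin (λ j → k i j) ≡ r * p) →
          Q c (λ j → t (⟪ (λ i → k i j) ⟫))
lemma27 r s _ _ c zero p-prime _ _ _ _ _ _ _ = ⊥-elim (¬prime[0] p-prime)
lemma27 r s _ _ c (suc n) _ _ t (preservesPQ , _) (rotateInBlocks , _) k k≤p rows =
  Q-respects-weight c (weight-cong (sym ∘ unrotate))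
    (preservesPQ columns (λ idx → weight≡r⇒P c (arcs-cover r (k (block idx)) (k≤p (block idx)) (rows (block idx)) (position idx))))
  where
  open Arcs n
  block : Fin (suc n * suc n) → Fin (suc n)
  block idx = proj₁ (remQuot {suc n} (suc n) idx)
  position : Fin (suc n * suc n) → Fin (suc n)
  position idx = proj₂ (remQuot {suc n} (suc n) idx)
  rotated : Fin s → Fin (suc n) → Fin (suc n) → Bool
  rotated j i = arc (prefixSum (k i) j) (k i j)
  columns : Fin (suc n * suc n) → Tuple s
  columns idx j = fromBlocks (rotated j) idx
  unrotate : ∀ j → t ⟪ (λ i → k i j) ⟫ ≡ t (fromBlocks (rotated j))
  unrotate j = rotateInBlocks (λ i → ⟨ k i j ⟩[ suc n ]) (λ i → suc n ∸ prefixSum (k i) j % suc n)
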